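{- If $n_1 \ge 2$ and $n_2 \ge 2$, then $\mathrm{ip}(K_{n_1} \Box K_{n_2}) = \lceil n_1 n_2/3 \rceil$.
   Context: An isometric path between two vertices of a graph is a shortest path joining them. The isometric path number $\mathrm{ip}(G)$ of a graph $G$ is the minimum number of isometric paths needed to cover all vertices of $G$. $K_m$ denotes the complete graph on $m$ vertices. The Cartesian product $K_{n_1} \Box \cdots \Box K_{n_r}$ has vertex set $\{(x_1,\ldots,x_r) : 0 \le x_i < n_i\}$, with two vertices adjacent if and only if they differ in exactly one coordinate. -}

module Defs where

open import Data.Nat using (ℕ; zero; suc; _+_; _*_; _≤_)
open import Data.Nat.DivMod using (_/_)
open import Data.Fin using (Fin)
open import Data.Product using (_×_; _,_; Σ)
open import Data.Sum using (_⊎_)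
open import Data.List using (List; length)
open import Data.List.Relation.Unary.Any using (Any)
open import Relation.Binary.PropositionalEquality using (_≡_)
open import Relation.Nullary using (¬_)

record Graph : Set₁ where
  field
    V   : Set
    Adj : V → V → Set

open Graph public

K : ℕ → Graph
K m = record { V = Fin m ; Adj = λ x y → ¬ (x ≡ y) }

_□_ : Graph → Graph → Graph
G □ H = record
  { V   = V G × V H
  ; Adj = λ { (g , h) (g' , h') →
              (Adj G g g' × h ≡ h') ⊎ (g ≡ g' × Adj H h h') } }

data Walk (G : Graph) : V G → V G → ℕ → Set where
  here : ∀ {v} → Walk G v v 0
  step : ∀ {u w v k} → Adj G u w → Walk G w v k → Walk G u v (suc k)

data OnWalk (G : Graph) (x : V G) : ∀ {u v k} → Walk G u v k → Set where
  on-here  : OnWalk G x (here {v = x})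
  on-start : ∀ {w v k} (a : Adj G x w) (p : Walk G w v k) → OnWalk G x (step a p)
  on-later : ∀ {u w v k} (a : Adj G u w) (p : Walk G w v k) →
             OnWalk G x p → OnWalk G x (step a p)

-- An isometric path: a walk from u to v of length k that is a shortest
-- u–v walk (hence a shortest path).
record IsoPath (G : Graph) : Set where
  field
    start end : V G
    len       : ℕ
    walk      : Walk G start end len
    shortest  : ∀ {k} → Walk G start end k → len ≤ k

IsoCover : (G : Graph) → List (IsoPath G) → Set
IsoCover G ps = ∀ (x : V G) → Any (λ p → OnWalk G x (IsoPath.walk p)) ps

ip≡ : Graph → ℕ → Set
ip≡ G k = Σ (List (IsoPath G)) (λ ps → IsoCover G ps × length ps ≡ k)
        × (∀ ps → IsoCover G ps → k ≤ length ps)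

⌈_/3⌉ : ℕ → ℕ
⌈ m /3⌉ = (m + 2) / 3

{-# OPTIONS --safe #-}

-- The rook graph K n₁ □ K n₂ has diameter 2, so an isometric path in it has at most three
-- vertices and at least ⌈n₁n₂/3⌉ of them are needed. Conversely the three vertices
-- (r , c'), (r , c), (r' , c) with r ≠ r' and c ≠ c' form an isometric path, and for
-- n₁, n₂ ≥ 2 the grid can be covered by ⌈n₁n₂/3⌉ such L-shapes: a 3 × m strip by m of
-- them, which reduces everything to grids of size at most 4 × 4.

module Submission where

open import Defs
open import Data.Nat as ℕ using (ℕ; zero; suc; _+_; _*_; _≤_; _<_; z≤n; s≤s)
import Data.Nat.Properties as ℕ
open import Data.Nat.DivMod using (_/_; m*n/n≡m; +-distrib-/-∣ˡ; m<n*o⇒m/o<n)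
open import Data.Nat.Divisibility using (n∣m*n)
open import Data.Fin using (Fin; toℕ; fromℕ<; _↑ˡ_; _↑ʳ_; splitAt)
open import Data.Fin.Patterns using (0F; 1F; 2F; 3F)
import Data.Fin.Properties as Fin
open import Data.Product using (_×_; _,_; ∃-syntax; Σ-syntax; proj₁; proj₂; map₁; swap)
open import Data.Product.Properties using (≡-dec)
open import Data.Sum using (_⊎_; inj₁; inj₂)
import Data.Sum as Sum
open import Data.List using (List; []; _∷_; length; map; _++_; lookup)
import Data.List.Properties as List
open import Data.List.Relation.Unary.Any as Any using (Any; any?)
import Data.List.Relation.Unary.Any.Properties as Any
open import Data.Empty using (⊥-elim)
open import Function using (_∘_)
open import Function.Bundles using (_↣_; mk↣; Injection)
open import Function.Definitions using (Injective)
open import Function.Properties.Inverse using (↔⇒↣; ↔-sym)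
open import Function.Construct.Composition using (_↣-∘_)
open import Relation.Binary.PropositionalEquality
open import Relation.Nullary using (¬_; Dec; yes; no)
open import Relation.Nullary.Decidable using (True; toWitness; _⊎-dec_)

⌈m*3+n/3⌉≡m+⌈n/3⌉ : ∀ m n → ⌈ m * 3 + n /3⌉ ≡ m + ⌈ n /3⌉
⌈m*3+n/3⌉≡m+⌈n/3⌉ m n = begin
  (m * 3 + n + 2) / 3       ≡⟨ cong (_/ 3) (ℕ.+-assoc (m * 3) n 2) ⟩
  (m * 3 + (n + 2)) / 3     ≡⟨ +-distrib-/-∣ˡ (n + 2) (n∣m*n m) ⟩
  m * 3 / 3 + (n + 2) / 3   ≡⟨ cong (_+ (n + 2) / 3) (m*n/n≡m m 3) ⟩
  m + (n + 2) / 3           ∎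
  where open ≡-Reasoning

⌈[3+m]*n/3⌉≡n+⌈m*n/3⌉ : ∀ m n → ⌈ (3 + m) * n /3⌉ ≡ n + ⌈ m * n /3⌉
⌈[3+m]*n/3⌉≡n+⌈m*n/3⌉ m n = begin
  ⌈ (3 + m) * n /3⌉     ≡⟨ cong ⌈_/3⌉ (ℕ.*-distribʳ-+ n 3 m) ⟩
  ⌈ 3 * n + m * n /3⌉   ≡⟨ cong (λ k → ⌈ k + m * n /3⌉) (ℕ.*-comm 3 n) ⟩
  ⌈ n * 3 + m * n /3⌉   ≡⟨ ⌈m*3+n/3⌉≡m+⌈n/3⌉ n (m * n) ⟩
  n + ⌈ m * n /3⌉       ∎
  where open ≡-Reasoning

⌈m*[3+n]/3⌉≡m+⌈m*n/3⌉ : ∀ m n → ⌈ m * (3 + n) /3⌉ ≡ m + ⌈ m * n /3⌉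
⌈m*[3+n]/3⌉≡m+⌈m*n/3⌉ m n =
  trans (cong ⌈_/3⌉ (ℕ.*-distribˡ-+ m 3 n)) (⌈m*3+n/3⌉≡m+⌈n/3⌉ m (m * n))

m≤n*3⇒⌈m/3⌉≤n : ∀ {m n} → m ≤ n * 3 → ⌈ m /3⌉ ≤ n
m≤n*3⇒⌈m/3⌉≤n {m} {n} m≤n*3 = ℕ.≤-pred (m<n*o⇒m/o<n {n = suc n} m+2<[1+n]*3)
  where
  m+2<[1+n]*3 : m + 2 < suc n * 3
  m+2<[1+n]*3 = begin-strict
    m + 2     <⟨ ℕ.+-monoʳ-< m (ℕ.n<1+n 2) ⟩
    m + 3     ≤⟨ ℕ.+-monoˡ-≤ 3 m≤n*3 ⟩
    n * 3 + 3 ≡⟨ ℕ.+-comm (n * 3) 3 ⟩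
    3 + n * 3 ∎
    where open ℕ.≤-Reasoning

Diameter≤ : Graph → ℕ → Set
Diameter≤ G d = ∀ u v → ∃[ k ] k ≤ d × Walk G u v k

module _ {G : Graph} where

  vertexAt : ∀ {u v k} → Walk G u v k → ℕ → V G
  vertexAt {u} here       _       = u
  vertexAt {u} (step _ w) zero    = u
  vertexAt     (step _ w) (suc i) = vertexAt w i

  OnWalk⇒vertexAt : ∀ {x u v k} {w : Walk G u v k} → OnWalk G x w →
                    ∃[ i ] i ≤ k × vertexAt w i ≡ x
  OnWalk⇒vertexAt on-here        = 0 , z≤n , refl
  OnWalk⇒vertexAt (on-start _ _) = 0 , z≤n , refl
  OnWalk⇒vertexAt (on-later _ _ x∈w) =
    let i , i≤k , eq = OnWalk⇒vertexAt x∈w in suc i , s≤s i≤k , eq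

  distinct-nonadjacent⇒2≤ : ∀ {u v k} → ¬ u ≡ v → ¬ Adj G u v → Walk G u v k → 2 ≤ k
  distinct-nonadjacent⇒2≤ u≢v _   here                = ⊥-elim (u≢v refl)
  distinct-nonadjacent⇒2≤ _   ¬uv (step uv here)      = ⊥-elim (¬uv uv)
  distinct-nonadjacent⇒2≤ _   _   (step _ (step _ _)) = s≤s (s≤s z≤n)

  module _ {d} (diam : Diameter≤ G d) where

    IsoPath-len≤ : (P : IsoPath G) → IsoPath.len P ≤ d
    IsoPath-len≤ P =
      let k , k≤d , w = diam (IsoPath.start P) (IsoPath.end P)
      in ℕ.≤-trans (IsoPath.shortest P w) k≤d

    IsoCover⇒↣ : ∀ ps → IsoCover G ps → V G ↣ (Fin (length ps) × Fin (suc d))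
    IsoCover⇒↣ ps cover = mk↣ {to = locate} locate-injective
      where
      vertex : Fin (length ps) × Fin (suc d) → V G
      vertex (j , t) = vertexAt (IsoPath.walk (lookup ps j)) (toℕ t)

      position : ∀ x → Σ[ p ∈ Fin (length ps) × Fin (suc d) ] vertex p ≡ x
      position x =
        let j = Any.index (cover x)
            i , i≤len , at≡x = OnWalk⇒vertexAt (Any.lookup-index (cover x))
            i<1+d = s≤s (ℕ.≤-trans i≤len (IsoPath-len≤ (lookup ps j)))
        in (j , fromℕ< i<1+d)
           , trans (cong (vertexAt (IsoPath.walk (lookup ps j))) (Fin.toℕ-fromℕ< i<1+d)) at≡x

      locate : V G → Fin (length ps) × Fin (suc d)
      locate = proj₁ ∘ position

      locate-injective : Injective _≡_ _≡_ locate
      locate-injective {x} {y} eq =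
        trans (sym (proj₂ (position x))) (trans (cong vertex eq) (proj₂ (position y)))

    IsoCover-length : ∀ {N} → Fin N ↣ V G → ∀ ps → IsoCover G ps → N ≤ length ps * suc d
    IsoCover-length ι ps cover =
      Fin.injective⇒≤ (Injection.injective (↔⇒↣ (↔-sym Fin.*↔×) ↣-∘ (IsoCover⇒↣ ps cover ↣-∘ ι)))

data Ell (a b : ℕ) : Set where
  ell : (r r' : Fin a) (c c' : Fin b) → ¬ r ≡ r' → ¬ c ≡ c' → Ell a b

-- The L-shape with corner (r , c); its points are listed in the order ellPath visits them.
_∈ᴸ_ : ∀ {a b} → Fin a × Fin b → Ell a b → Set
x ∈ᴸ ell r r' c c' _ _ = x ≡ (r , c') ⊎ x ≡ (r , c) ⊎ x ≡ (r' , c)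

Covers : ∀ {a b} → List (Ell a b) → Set
Covers ps = ∀ x → Any (x ∈ᴸ_) ps

Cover : ℕ → ℕ → ℕ → Set
Cover a b k = Σ[ ps ∈ List (Ell a b) ] length ps ≡ k × Covers ps

covers? : ∀ {a b} (ps : List (Ell a b)) → Dec (∀ r c → Any ((r , c) ∈ᴸ_) ps)
covers? ps = Fin.all? λ r → Fin.all? λ c → any? (λ L → member? (r , c) L) ps
  where
  _≟_ = ≡-dec Fin._≟_ Fin._≟_
  member? : ∀ x L → Dec (x ∈ᴸ L)
  member? x (ell r r' c c' _ _) = x ≟ (r , c') ⊎-dec x ≟ (r , c) ⊎-dec x ≟ (r' , c)

decide : ∀ {a b} (ps : List (Ell a b)) → {True (covers? ps)} → Cover a b (length ps)
decide ps {t} = ps , refl , λ (r , c) → toWitness t r c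

mapRows : ∀ {a a' b} (f : Fin a → Fin a') → Injective _≡_ _≡_ f → Ell a b → Ell a' b
mapRows f f-inj (ell r r' c c' r≢r' c≢c') = ell (f r) (f r') c c' (r≢r' ∘ f-inj) c≢c'

∈ᴸ-mapRows : ∀ {a a' b} (f : Fin a → Fin a') (f-inj : Injective _≡_ _≡_ f) {x} (L : Ell a b) →
             x ∈ᴸ L → map₁ f x ∈ᴸ mapRows f f-inj L
∈ᴸ-mapRows f _ (ell _ _ _ _ _ _) =
  Sum.map (cong (map₁ f)) (Sum.map (cong (map₁ f)) (cong (map₁ f)))

transposeᴸ : ∀ {a b} → Ell a b → Ell b a
transposeᴸ (ell r r' c c' r≢r' c≢c') = ell c c' r r' c≢c' r≢r'

∈ᴸ-transposeᴸ : ∀ {a b x} (L : Ell a b) → x ∈ᴸ L → swap x ∈ᴸ transposeᴸ L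
∈ᴸ-transposeᴸ (ell _ _ _ _ _ _) (inj₁ refl)        = inj₂ (inj₂ refl)
∈ᴸ-transposeᴸ (ell _ _ _ _ _ _) (inj₂ (inj₁ refl)) = inj₂ (inj₁ refl)
∈ᴸ-transposeᴸ (ell _ _ _ _ _ _) (inj₂ (inj₂ refl)) = inj₁ refl

transpose : ∀ {a b k} → Cover a b k → Cover b a k
transpose (ps , refl , cover) =
  map transposeᴸ ps , List.length-map transposeᴸ ps ,
  λ (c , r) → Any.map⁺ (Any.map (∈ᴸ-transposeᴸ _) (cover (r , c)))

above : ∀ {a a' b k k'} → Cover a b k → Cover a' b k' → Cover (a + a') b (k + k')
above {a} {a'} {b} (ps , refl , cover) (qs , refl , cover') =
  map top ps ++ map bottom qs , length-top++bottom , covers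
  where
  ↑ˡ-injective : Injective _≡_ _≡_ (_↑ˡ a')
  ↑ˡ-injective = Fin.↑ˡ-injective a' _ _

  ↑ʳ-injective : Injective _≡_ _≡_ (a ↑ʳ_)
  ↑ʳ-injective = Fin.↑ʳ-injective a _ _

  top : Ell a b → Ell (a + a') b
  top = mapRows (_↑ˡ a') ↑ˡ-injective

  bottom : Ell a' b → Ell (a + a') b
  bottom = mapRows (a ↑ʳ_) ↑ʳ-injective

  length-top++bottom : length (map top ps ++ map bottom qs) ≡ length ps + length qs
  length-top++bottom = begin
    length (map top ps ++ map bottom qs)         ≡⟨ List.length-++ (map top ps) ⟩
    length (map top ps) + length (map bottom qs) ≡⟨ cong₂ _+_ (List.length-map top ps)
                                                              (List.length-map bottom qs) ⟩
    length ps + length qs                        ∎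
    where open ≡-Reasoning

  covers : Covers (map top ps ++ map bottom qs)
  covers (r , c) with splitAt a r | Fin.join-splitAt a a' r
  ... | inj₁ i | refl =
    Any.++⁺ˡ (Any.map⁺ (Any.map (∈ᴸ-mapRows _ ↑ˡ-injective _) (cover (i , c))))
  ... | inj₂ j | refl =
    Any.++⁺ʳ (map top ps) (Any.map⁺ (Any.map (∈ᴸ-mapRows _ ↑ʳ-injective _) (cover' (j , c))))

beside : ∀ {a b b' k k'} → Cover a b k → Cover a b' k' → Cover a (b + b') (k + k')
beside left right = transpose (above (transpose left) (transpose right))

cover2×2 : Cover 2 2 2
cover2×2 = decide (ell 0F 1F 0F 1F (λ ()) (λ ()) ∷ ell 1F 0F 1F 0F (λ ()) (λ ()) ∷ [])

cover3×2 : Cover 3 2 2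
cover3×2 = decide (ell 0F 1F 0F 1F (λ ()) (λ ()) ∷ ell 2F 1F 1F 0F (λ ()) (λ ()) ∷ [])

cover3×3 : Cover 3 3 3
cover3×3 = decide (ell 0F 1F 0F 1F (λ ()) (λ ()) ∷ ell 1F 2F 1F 2F (λ ()) (λ ())
                   ∷ ell 2F 0F 2F 0F (λ ()) (λ ()) ∷ [])

cover2×4 : Cover 2 4 3
cover2×4 = decide (ell 0F 1F 0F 1F (λ ()) (λ ()) ∷ ell 1F 0F 1F 2F (λ ()) (λ ())
                   ∷ ell 0F 1F 3F 2F (λ ()) (λ ()) ∷ [])

strip : ∀ b → Cover 3 (2 + b) (2 + b)
strip zero          = cover3×2
strip (suc zero)    = cover3×3
strip (suc (suc b)) = beside cover3×2 (strip b)

grid : ∀ a b → Cover (2 + a) (2 + b) ⌈ (2 + a) * (2 + b) /3⌉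
grid (suc (suc (suc a))) b =
  subst (Cover _ _) (sym (⌈[3+m]*n/3⌉≡n+⌈m*n/3⌉ (2 + a) (2 + b)))
        (above (strip b) (grid a b))
grid a (suc (suc (suc b))) =
  subst (Cover _ _) (sym (⌈m*[3+n]/3⌉≡m+⌈m*n/3⌉ (2 + a) (2 + b)))
        (beside (transpose (strip a)) (grid a b))
grid 0 0 = cover2×2
grid 0 1 = transpose cover3×2
grid 0 2 = cover2×4
grid 1 0 = strip 0
grid 1 1 = strip 1
grid 1 2 = strip 2
grid 2 0 = transpose cover2×4
grid 2 1 = transpose (strip 2)
grid 2 2 = above cover2×4 cover2×4

K□K-diameter≤2 : ∀ a b → Diameter≤ (K a □ K b) 2
K□K-diameter≤2 a b (r , c) (r' , c') with r Fin.≟ r' | c Fin.≟ c'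
... | yes refl | yes refl = 0 , z≤n , here
... | yes refl | no c≢c'  = 1 , s≤s z≤n , step (inj₂ (refl , c≢c')) here
... | no r≢r'  | yes refl = 1 , s≤s z≤n , step (inj₁ (r≢r' , refl)) here
... | no r≢r'  | no c≢c'  =
  2 , s≤s (s≤s z≤n) , step (inj₂ (refl , c≢c')) (step (inj₁ (r≢r' , refl)) here)

ellPath : ∀ {a b} → Ell a b → IsoPath (K a □ K b)
ellPath {a} {b} (ell r r' c c' r≢r' c≢c') = record
  { start    = r , c'
  ; end      = r' , c
  ; len      = 2
  ; walk     = step (inj₂ (refl , c≢c' ∘ sym)) (step (inj₁ (r≢r' , refl)) here)
  ; shortest = distinct-nonadjacent⇒2≤ (r≢r' ∘ cong proj₁) nonadjacent
  }
  where
  nonadjacent : ¬ Adj (K a □ K b) (r , c') (r' , c)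
  nonadjacent (inj₁ (_ , c'≡c)) = c≢c' (sym c'≡c)
  nonadjacent (inj₂ (r≡r' , _)) = r≢r' r≡r'

∈ᴸ⇒OnWalk : ∀ {a b x} (L : Ell a b) → x ∈ᴸ L → OnWalk (K a □ K b) x (IsoPath.walk (ellPath L))
∈ᴸ⇒OnWalk (ell _ _ _ _ _ _) (inj₁ refl)        = on-start _ _
∈ᴸ⇒OnWalk (ell _ _ _ _ _ _) (inj₂ (inj₁ refl)) = on-later _ _ (on-start _ _)
∈ᴸ⇒OnWalk (ell _ _ _ _ _ _) (inj₂ (inj₂ refl)) = on-later _ _ (on-later _ _ on-here)

Cover⇒IsoCover : ∀ {a b k} → Cover a b k →
                 Σ[ ps ∈ List (IsoPath (K a □ K b)) ] IsoCover (K a □ K b) ps × length ps ≡ k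
Cover⇒IsoCover (ps , refl , cover) =
  map ellPath ps , (λ x → Any.map⁺ (Any.map (∈ᴸ⇒OnWalk _) (cover x))) , List.length-map ellPath ps

theorem6 : (n₁ n₂ : ℕ) → 2 ≤ n₁ → 2 ≤ n₂ →
    ip≡ (K n₁ □ K n₂) ⌈ n₁ * n₂ /3⌉
theorem6 (suc (suc a)) (suc (suc b)) (s≤s (s≤s z≤n)) (s≤s (s≤s z≤n)) =
  Cover⇒IsoCover (grid a b) , λ ps cover →
    m≤n*3⇒⌈m/3⌉≤n (IsoCover-length (K□K-diameter≤2 _ _) (↔⇒↣ Fin.*↔×) ps cover)
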